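{- Let $G$ be a generalized comb with sets $A_0,\dots,A_n,M_1,\dots,M_l,X_1,\dots,X_{n+1},Y_2,\dots,Y_{l+2}$ (and $Y_1=X_1$) as in the definition below. Then the graph $G'=G-\bigcup_{1\le i\le l}E[Y_i,M_i]$ (obtained from $G$ by deleting all edges joining $Y_i$ to $M_i$ for $1\le i\le l$) is a threshold graph.
   Context: For vertex sets $U,W$ of a graph, $E[U,W]$ is the set of edges joining a vertex of $U$ to a vertex of $W$. A graph whose vertex set is the disjoint union of a stable set $S$ and a clique $K$ is a split graph; it is a complete split graph if every vertex of $S$ is adjacent to every vertex of $K$, and a perfect split graph if $E[S,K]$ is a perfect matching of the graph. A graph $G$ is a threshold graph if: $V(G)=\bigcup_{i=1}^{n+1}(X_i\cup A_{i-1})$ with the $A_i$'s and $X_i$'s pairwise disjoint; $K=\bigcup_{i=1}^{n+1}X_i$ is a clique with all $X_i$ nonempty except possibly $X_{n+1}$; $S=\bigcup_{i=0}^{n}A_i$ is a stable set with all $A_i$ nonempty except possibly $A_0$; for all $1\le j\le i\le n$, $G[A_i\cup X_j]$ is a complete split graph; and these are the only edges of $G$. A graph $G$ is a generalized comb if: (1) $V(G)$ is the disjoint union of sets $A_0,\dots,A_n,M_1,\dots,M_l,X_1,\dots,X_{n+1},Y_2,\dots,Y_{l+2}$, with $Y_1:=X_1$; (2) $S=A\cup M$ is stable, where $A=\bigcup_{i=0}^n A_i$, $M=\bigcup_{i=1}^l M_i$; (3) $K=X\cup Y$ is a clique, where $X=\bigcup_{i=1}^{n+1}X_i$, $Y=\bigcup_{i=1}^{l+2}Y_i$;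 (4) for all $1\le j\le i\le n$, $G[A_i\cup X_j]$ is a complete split graph; (5) $G[A\cup Y]$ is a complete split graph; (6) for all $1\le i\le l$, $G[Y_i\cup M_i]$ is a perfect split graph or $M_i=\emptyset$; (7) for all $1\le i<j\le l+1$, $G[Y_j\cup M_i]$ is a complete split graph; (8) $X_{n+1},Y_{l+2},Y_{l+1},A_0$ are the only possibly empty sets among the $X_i$'s, $Y_i$'s, $A_i$'s; (9) the only edges of $G$ are the edges of the subgraphs mentioned above. -}

module Defs where

open import Data.Nat using (ℕ; zero; suc; _≤_; _<_)
open import Data.Fin using (Fin)
open import Data.Product using (Σ; ∃; ∃₂; _×_; _,_)
open import Data.Sum using (_⊎_)
open import Data.Empty using (⊥)
open import Relation.Nullary using (¬_)
open import Relation.Binary.PropositionalEquality using (_≡_)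
open import Function.Bundles using (_⇔_)

record SimpleGraph (N : ℕ) : Set₁ where
  field
    Adj   : Fin N → Fin N → Set
    sym   : ∀ {u v} → Adj u v → Adj v u
    irrefl : ∀ {v} → ¬ Adj v v

VSet : ℕ → Set₁
VSet N = Fin N → Set

module _ {N : ℕ} (Adj : Fin N → Fin N → Set) where

  Stable : VSet N → Set
  Stable S = ∀ u v → S u → S v → ¬ Adj u v

  Clique : VSet N → Set
  Clique K = ∀ u v → K u → K v → ¬ (u ≡ v) → Adj u v

  CompleteSplit : VSet N → VSet N → Set
  CompleteSplit S K = Stable S × Clique K × (∀ s k → S s → K k → Adj s k)

  ExactlyOne : (Fin N → Set) → Set
  ExactlyOne P = Σ (Fin N) λ w → P w × (∀ w' → P w' → w' ≡ w)

  PerfectSplit : VSet N → VSet N → Set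
  PerfectSplit S K =
    Stable S × Clique K ×
    (∀ s → S s → ExactlyOne (λ k → K k × Adj s k)) ×
    (∀ k → K k → ExactlyOne (λ s → S s × Adj s k))

-- Generalized combs.  The partition of V(G) into
-- A_0..A_n, M_1..M_l, X_1..X_{n+1}, Y_2..Y_{l+2}
-- is given by a labelling function into the following labels.

data CombLabel : Set where
  lA lM lX lY : ℕ → CombLabel

ValidCombLabel : ℕ → ℕ → CombLabel → Set
ValidCombLabel n l (lA i) = i ≤ n
ValidCombLabel n l (lM i) = 1 ≤ i × i ≤ l
ValidCombLabel n l (lX i) = 1 ≤ i × i ≤ suc n
ValidCombLabel n l (lY i) = 2 ≤ i × i ≤ suc (suc l)

module CombSets {N : ℕ} (part : Fin N → CombLabel) where

  inA : ℕ → VSet N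
  inA i v = part v ≡ lA i

  inM : ℕ → VSet N
  inM i v = part v ≡ lM i

  inX : ℕ → VSet N
  inX i v = part v ≡ lX i

  inY : ℕ → VSet N
  inY zero v = ⊥
  inY (suc zero) v = part v ≡ lX 1
  inY (suc (suc k)) v = part v ≡ lY (suc (suc k))

  inAll-A : VSet N
  inAll-A v = ∃ λ i → inA i v
  inAll-M : VSet N
  inAll-M v = ∃ λ i → inM i v
  inAll-X : VSet N
  inAll-X v = ∃ λ i → inX i v
  inAll-Y : VSet N
  inAll-Y v = ∃ λ i → inY i v

  inS : VSet N
  inS v = inAll-A v ⊎ inAll-M v

  inK : VSet N
  inK v = inAll-X v ⊎ inAll-Y v

  Empty : VSet N → Set
  Empty P = ∀ v → ¬ P v

  Nonempty : VSet N → Set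
  Nonempty P = ∃ λ v → P v

module _ {N : ℕ} (G : SimpleGraph N) (n l : ℕ) (part : Fin N → CombLabel) where
  open SimpleGraph G
  open CombSets part

  CombEdge : Fin N → Fin N → Set
  CombEdge u v =
      (inK u × inK v)
    ⊎ (∃₂ λ i j → 1 ≤ j × j ≤ i × i ≤ n × inA i u × inX j v)
    ⊎ (inAll-A u × inAll-Y v)
    ⊎ (∃ λ i → 1 ≤ i × i ≤ l × inM i u × inY i v)
    ⊎ (∃₂ λ i j → 1 ≤ i × i < j × j ≤ suc l × inM i u × inY j v)

  record IsGeneralizedComb : Set where
    field
      -- (1) V(G) is the disjoint union of the sets (via the labelling)
      valid     : ∀ v → ValidCombLabel n l (part v)
      S-stable  : Stable Adj inS
      K-clique  : Clique Adj inK
      AX-complete : ∀ i j → 1 ≤ j → j ≤ i → i ≤ n →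
                    CompleteSplit Adj (inA i) (inX j)
      AY-complete : CompleteSplit Adj inAll-A inAll-Y
      YM-perfect : ∀ i → 1 ≤ i → i ≤ l →
                   PerfectSplit Adj (inM i) (inY i) ⊎ Empty (inM i)
      YM-complete : ∀ i j → 1 ≤ i → i < j → j ≤ suc l →
                    CompleteSplit Adj (inM i) (inY j)
      -- (8) nonemptiness (Y_1 = X_1 counts among the Y_i's)
      X-nonempty : ∀ i → 1 ≤ i → i ≤ n → Nonempty (inX i)
      A-nonempty : ∀ i → 1 ≤ i → i ≤ n → Nonempty (inA i)
      Y-nonempty : ∀ i → 1 ≤ i → i ≤ l → Nonempty (inY i)
      only-edges : ∀ u v → Adj u v → CombEdge u v ⊎ CombEdge v u

  RemovedEdge : Fin N → Fin N → Set
  RemovedEdge u v = ∃ λ i → 1 ≤ i × i ≤ l ×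
    ((inY i u × inM i v) ⊎ (inY i v × inM i u))

  Adj' : Fin N → Fin N → Set
  Adj' u v = Adj u v × ¬ RemovedEdge u v

data ThrLabel : Set where
  tA tX : ℕ → ThrLabel

ValidThrLabel : ℕ → ThrLabel → Set
ValidThrLabel m (tA i) = i ≤ m
ValidThrLabel m (tX i) = 1 ≤ i × i ≤ suc m

module _ {N : ℕ} (Adj : Fin N → Fin N → Set) where

  ThrEdge : (m : ℕ) (tp : Fin N → ThrLabel) → Fin N → Fin N → Set
  ThrEdge m tp u v =
      ((∃ λ i → tp u ≡ tX i) × (∃ λ j → tp v ≡ tX j) × ¬ (u ≡ v))
    ⊎ (∃₂ λ i j → 1 ≤ j × j ≤ i × i ≤ m × tp u ≡ tA i × tp v ≡ tX j)

  IsThresholdWith : (m : ℕ) → (Fin N → ThrLabel) → Set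
  IsThresholdWith m tp =
      (∀ v → ValidThrLabel m (tp v))
    × (∀ i → 1 ≤ i → i ≤ m → ∃ λ v → tp v ≡ tX i)
    × (∀ i → 1 ≤ i → i ≤ m → ∃ λ v → tp v ≡ tA i)
    × (∀ u v → Adj u v ⇔ (ThrEdge m tp u v ⊎ ThrEdge m tp v u))

  IsThreshold : Set
  IsThreshold = Σ ℕ λ m → Σ (Fin N → ThrLabel) λ tp → IsThresholdWith m tp

-- Once the matchings E[Y_i, M_i] are deleted, the neighbourhoods in K of the
-- stable vertices are nested: A_i sees all of Y together with X_1, …, X_i, and
-- M_i sees Y_{i+1}, …, Y_{l+1}.  Ranking K as Y_{l+1}, …, Y_2, X_1 ∪ Y_{l+2},
-- X_2, …, X_{n+1} and the stable classes accordingly gives a threshold labelling,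
-- except that some levels may be empty (M_i, A_0, X_{n+1}, Y_{l+1}, Y_{l+2} may
-- be).  Each empty level is removed by merging it with a neighbouring level,
-- which changes no adjacency.
module Submission where

open import Defs
open import Data.Nat using (ℕ; zero; suc; _+_; _∸_; _≤_; _<_; z≤n; s≤s)
open import Data.Nat.Properties
open import Data.Fin using (Fin)
open import Data.Fin.Properties using (any?)
open import Data.Product using (∃; ∃₂; _×_; _,_; proj₁; proj₂)
open import Data.Product.Function.NonDependent.Propositional using (_×-⇔_)
open import Data.Sum using (_⊎_; inj₁; inj₂)
open import Data.Sum.Function.Propositional using (_⊎-⇔_)
open import Data.Empty using (⊥)
open import Data.Unit using (⊤; tt)
open import Function using (_∘_)
open import Function.Bundles using (_⇔_; mk⇔)
open import Function.Construct.Identity using (⇔-id)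
open import Function.Construct.Composition using (_⇔-∘_)
open import Relation.Nullary using (Dec; yes; no; ¬_; contradiction)
open import Relation.Nullary.Decidable using (map′; _×-dec_; ¬?; decidable-stable)
open import Relation.Binary.Definitions using (DecidableEquality)
open import Relation.Binary.PropositionalEquality using (_≡_; _≢_; refl; sym; trans; cong; subst; subst₂)

pinch : ℕ → ℕ → ℕ
pinch zero    zero    = zero
pinch zero    (suc j) = j
pinch (suc c) zero    = zero
pinch (suc c) (suc j) = suc (pinch c j)

pinch-≤ : ∀ c j → pinch c j ≤ j
pinch-≤ zero    zero    = z≤n
pinch-≤ zero    (suc j) = n≤1+n j
pinch-≤ (suc c) zero    = z≤n
pinch-≤ (suc c) (suc j) = s≤s (pinch-≤ c j)

≤-suc-pinch : ∀ c j → j ≤ suc (pinch c j)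
≤-suc-pinch zero    zero    = z≤n
≤-suc-pinch zero    (suc j) = ≤-refl
≤-suc-pinch (suc c) zero    = z≤n
≤-suc-pinch (suc c) (suc j) = s≤s (≤-suc-pinch c j)

pinch-mono-≤ : ∀ c {j a} → j ≤ a → pinch c j ≤ pinch c a
pinch-mono-≤ zero    {zero}              _         = z≤n
pinch-mono-≤ zero    {suc j} {suc a}     (s≤s j≤a) = j≤a
pinch-mono-≤ (suc c) {zero}              _         = z≤n
pinch-mono-≤ (suc c) {suc j} {suc a}     (s≤s j≤a) = s≤s (pinch-mono-≤ c j≤a)

pinch-cancel-≤ : ∀ c {j a} → pinch c j ≤ pinch c a → j ≤ a ⊎ (j ≡ suc c × a ≡ c)
pinch-cancel-≤ zero    {zero}                 _  = inj₁ z≤n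
pinch-cancel-≤ zero    {suc zero}    {zero}   _  = inj₂ (refl , refl)
pinch-cancel-≤ zero    {suc (suc j)} {zero}   ()
pinch-cancel-≤ zero    {suc j}       {suc a}  le = inj₁ (s≤s le)
pinch-cancel-≤ (suc c) {zero}                 _  = inj₁ z≤n
pinch-cancel-≤ (suc c) {suc j}       {suc a}  (s≤s le) with pinch-cancel-≤ c le
... | inj₁ j≤a               = inj₁ (s≤s j≤a)
... | inj₂ (refl , refl)     = inj₂ (refl , refl)

pinch-positive : ∀ c {j} → 1 ≤ j → j ≢ suc c ⊎ 1 ≤ c → 1 ≤ pinch c j
pinch-positive zero    {suc zero}    _ (inj₁ j≢1) = contradiction refl j≢1
pinch-positive zero    {suc (suc j)} _ _          = s≤s z≤n
pinch-positive (suc c) {suc j}       _ _          = s≤s z≤n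

pinch-bounded : ∀ c {j m} → j ≤ suc m → (j ≤ c → j ≤ m) → pinch c j ≤ m
pinch-bounded zero    {zero}                 _         _ = z≤n
pinch-bounded zero    {suc j}                (s≤s j≤m) _ = j≤m
pinch-bounded (suc c) {zero}                 _         _ = z≤n
pinch-bounded (suc c) {suc j} {zero}         (s≤s z≤n) h = contradiction (h (s≤s z≤n)) λ ()
pinch-bounded (suc c) {suc j} {suc m}        (s≤s j≤m) h =
  s≤s (pinch-bounded c j≤m (≤-pred ∘ h ∘ s≤s))

mapLevel : (ℕ → ℕ) → ThrLabel → ThrLabel
mapLevel f (tA a) = tA (f a)
mapLevel f (tX j) = tX (f j)

_≟ᵗ_ : DecidableEquality ThrLabel
tA a ≟ᵗ tA b = map′ (cong tA) (λ { refl → refl }) (a ≟ b)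
tA a ≟ᵗ tX b = no λ ()
tX a ≟ᵗ tA b = no λ ()
tX a ≟ᵗ tX b = map′ (cong tX) (λ { refl → refl }) (a ≟ b)

IsX : ThrLabel → Set
IsX (tA _) = ⊥
IsX (tX _) = ⊤

AXEdge : ℕ → ThrLabel → ThrLabel → Set
AXEdge m (tA a) (tX j) = 1 ≤ j × j ≤ a × a ≤ m
AXEdge m _      _      = ⊥

-- An edge of a threshold graph with m levels between vertices labelled p and q,
-- where D states that the two vertices are distinct.
LevelEdge : ℕ → ThrLabel → ThrLabel → Set → Set
LevelEdge m p q D = (IsX p × IsX q × D) ⊎ AXEdge m p q

IsX⇔≡tX : ∀ {p} → IsX p ⇔ ∃ λ i → p ≡ tX i
IsX⇔≡tX {tA _} = mk⇔ (λ ()) λ { (_ , ()) }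
IsX⇔≡tX {tX i} = mk⇔ (λ _ → i , refl) (λ _ → tt)

AXEdge⇒≡ : ∀ {m} p q → AXEdge m p q → ∃₂ λ i j → 1 ≤ j × j ≤ i × i ≤ m × p ≡ tA i × q ≡ tX j
AXEdge⇒≡ (tA i) (tX j) (1≤j , j≤i , i≤m) = i , j , 1≤j , j≤i , i≤m , refl , refl

AXEdge⇔≡ : ∀ {m p q} → AXEdge m p q ⇔ ∃₂ λ i j → 1 ≤ j × j ≤ i × i ≤ m × p ≡ tA i × q ≡ tX j
AXEdge⇔≡ {p = p} {q} = mk⇔ (AXEdge⇒≡ p q) λ { (_ , _ , 1≤j , j≤i , i≤m , refl , refl) → 1≤j , j≤i , i≤m }

IsX-mapLevel : ∀ f {p} → IsX p ⇔ IsX (mapLevel f p)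
IsX-mapLevel f {tA _} = ⇔-id _
IsX-mapLevel f {tX _} = ⇔-id _

-- pinch c merges levels c and suc c; this preserves adjacency as long as the one
-- label g that would gain or lose neighbours (X_{c+1}, resp. A_c) is unused.
data PinchGap (m : ℕ) : ℕ → ThrLabel → Set where
  emptyX : ∀ {k} → k ≤ m → PinchGap m k (tX (suc k))
  emptyA : ∀ {k} → k ≤ m → PinchGap m (suc k) (tA (suc k))

module _ {m : ℕ} where

  private
    pinch-point≤ : ∀ {c g} → PinchGap m c g → c ≤ suc m
    pinch-point≤ (emptyX k≤m) = m≤n⇒m≤1+n k≤m
    pinch-point≤ (emptyA k≤m) = s≤s k≤m

    pinch-positiveˣ : ∀ {c g j} → PinchGap m c g → 1 ≤ j → tX j ≢ g → 1 ≤ pinch c j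
    pinch-positiveˣ {c} (emptyX _) 1≤j x≢g = pinch-positive c 1≤j (inj₁ (x≢g ∘ cong tX))
    pinch-positiveˣ {c} (emptyA _) 1≤j x≢g = pinch-positive c 1≤j (inj₂ (s≤s z≤n))

    pinch-boundedᵃ : ∀ {c g a} → PinchGap m c g → a ≤ suc m → tA a ≢ g → pinch c a ≤ m
    pinch-boundedᵃ {c} (emptyX k≤m) a≤1+m a≢g = pinch-bounded c a≤1+m λ a≤k → ≤-trans a≤k k≤m
    pinch-boundedᵃ {c} (emptyA k≤m) a≤1+m a≢g = pinch-bounded c a≤1+m λ a≤1+k →
      ≤-trans (≤-pred (≤∧≢⇒< a≤1+k (a≢g ∘ cong tA))) k≤m

    pinch-cancelᵃˣ : ∀ {c g j a} → PinchGap m c g → pinch c j ≤ pinch c a → tA a ≢ g → tX j ≢ g → j ≤ a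
    pinch-cancelᵃˣ {c} gap le a≢g x≢g with pinch-cancel-≤ c le | gap
    ... | inj₁ j≤a        | _        = j≤a
    ... | inj₂ (refl , _) | emptyX _ = contradiction refl x≢g
    ... | inj₂ (_ , refl) | emptyA _ = contradiction refl a≢g

  pinch-valid : ∀ {c g p} → PinchGap m c g → p ≢ g →
                ValidThrLabel (suc m) p → ValidThrLabel m (mapLevel (pinch c) p)
  pinch-valid {p = tA a} gap a≢g a≤1+m = pinch-boundedᵃ gap a≤1+m a≢g
  pinch-valid {c} {p = tX j} gap x≢g (1≤j , j≤2+m) =
    pinch-positiveˣ gap 1≤j x≢g , pinch-bounded c j≤2+m λ j≤c → ≤-trans j≤c (pinch-point≤ gap)

  pinch-AXEdge : ∀ {c g p q} → PinchGap m c g → p ≢ g → q ≢ g →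
                 AXEdge (suc m) p q ⇔ AXEdge m (mapLevel (pinch c) p) (mapLevel (pinch c) q)
  pinch-AXEdge {c} {p = tA a} {tX j} gap a≢g x≢g = mk⇔
    (λ (1≤j , j≤a , a≤1+m) →
      pinch-positiveˣ gap 1≤j x≢g , pinch-mono-≤ c j≤a , pinch-boundedᵃ gap a≤1+m a≢g)
    (λ (1≤j' , j'≤a' , a'≤m) →
      ≤-trans 1≤j' (pinch-≤ c j) , pinch-cancelᵃˣ gap j'≤a' a≢g x≢g , ≤-trans (≤-suc-pinch c a) (s≤s a'≤m))
  pinch-AXEdge {p = tA a} {tA b} _ _ _ = ⇔-id _
  pinch-AXEdge {p = tX i}        _ _ _ = ⇔-id _

  pinch-LevelEdge : ∀ {c g p q D} → PinchGap m c g → p ≢ g → q ≢ g →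
                    LevelEdge (suc m) p q D ⇔ LevelEdge m (mapLevel (pinch c) p) (mapLevel (pinch c) q) D
  pinch-LevelEdge {c} gap p≢g q≢g =
    (IsX-mapLevel (pinch c) ×-⇔ IsX-mapLevel (pinch c) ×-⇔ ⇔-id _) ⊎-⇔ pinch-AXEdge gap p≢g q≢g

module _ {N : ℕ} (Adj : Fin N → Fin N → Set) where

  levelEdge⇔thrEdge : ∀ {m tp u v} → LevelEdge m (tp u) (tp v) (u ≢ v) ⇔ ThrEdge Adj m tp u v
  levelEdge⇔thrEdge = (IsX⇔≡tX ×-⇔ IsX⇔≡tX ×-⇔ ⇔-id _) ⊎-⇔ AXEdge⇔≡

  -- A threshold labelling in which levels are allowed to be empty.
  record IsWeakThresholdWith (m : ℕ) (tp : Fin N → ThrLabel) : Set where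
    field
      valid : ∀ v → ValidThrLabel m (tp v)
      adj⇔  : ∀ u v → Adj u v ⇔ (LevelEdge m (tp u) (tp v) (u ≢ v) ⊎ LevelEdge m (tp v) (tp u) (v ≢ u))

  Occupied : (Fin N → ThrLabel) → ThrLabel → Set
  Occupied tp p = ∃ λ v → tp v ≡ p

  occupied? : ∀ tp p → Dec (Occupied tp p)
  occupied? tp p = any? λ v → tp v ≟ᵗ p

  pinch-weakThreshold : ∀ {m c g tp} → IsWeakThresholdWith (suc m) tp → PinchGap m c g →
                        (∀ v → tp v ≢ g) → IsWeakThresholdWith m (mapLevel (pinch c) ∘ tp)
  pinch-weakThreshold w gap unused = record
    { valid = λ v → pinch-valid gap (unused v) (valid v)
    ; adj⇔  = λ u v →
        (pinch-LevelEdge gap (unused u) (unused v) ⊎-⇔ pinch-LevelEdge gap (unused v) (unused u)) ⇔-∘ adj⇔ u v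
    }
    where open IsWeakThresholdWith w

  removeEmptyLevel : ∀ {m k tp} → IsWeakThresholdWith (suc m) tp → k ≤ m →
                     ¬ (Occupied tp (tX (suc k)) × Occupied tp (tA (suc k))) →
                     ∃ λ tp′ → IsWeakThresholdWith m tp′
  removeEmptyLevel {k = k} {tp} w k≤m ¬occupied with occupied? tp (tX (suc k))
  ... | yes x  = _ , pinch-weakThreshold w (emptyA k≤m) λ v a → ¬occupied (x , v , a)
  ... | no ¬x  = _ , pinch-weakThreshold w (emptyX k≤m) λ v x → ¬x (v , x)

  weakThreshold⇒threshold : ∀ m {tp} → IsWeakThresholdWith m tp → IsThreshold Adj
  weakThreshold⇒threshold m {tp} w
    with anyUpTo? (λ k → ¬? (occupied? tp (tX (suc k)) ×-dec occupied? tp (tA (suc k)))) m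
  ... | no noEmptyLevel = m , tp , valid , (λ i 1≤i i≤m → proj₁ (occupied i 1≤i i≤m)) ,
                          (λ i 1≤i i≤m → proj₂ (occupied i 1≤i i≤m)) ,
                          λ u v → (levelEdge⇔thrEdge ⊎-⇔ levelEdge⇔thrEdge) ⇔-∘ adj⇔ u v
    where
    open IsWeakThresholdWith w
    occupied : ∀ i → 1 ≤ i → i ≤ m → Occupied tp (tX i) × Occupied tp (tA i)
    occupied (suc k) _ k<m = decidable-stable (occupied? tp (tX (suc k)) ×-dec occupied? tp (tA (suc k)))
                               λ ¬occupied → noEmptyLevel (k , k<m , ¬occupied)
  weakThreshold⇒threshold (suc m) w | yes (k , s≤s k≤m , ¬occupied) =
    weakThreshold⇒threshold m (proj₂ (removeEmptyLevel w k≤m ¬occupied))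

aLevel : ℕ → ℕ → ℕ
aLevel l zero    = suc l
aLevel l (suc i) = suc (i + l)

yLevel : ℕ → ℕ → ℕ
yLevel l j with j ≤? suc l
... | yes _ = suc (suc l) ∸ j
... | no  _ = suc l

-- M_i sits at level l+1-i and Y_j (2 ≤ j ≤ l+1) at level l+2-j, so that M_i sees
-- Y_j exactly when i < j; X_j and A_i sit at level l+j and l+i, except that A_0
-- joins A_1, and Y_{l+2} joins Y_1 = X_1, at level l+1.
combLevel : ℕ → CombLabel → ThrLabel
combLevel l (lA i) = tA (aLevel l i)
combLevel l (lM i) = tA (suc l ∸ i)
combLevel l (lX j) = tX (j + l)
combLevel l (lY j) = tX (yLevel l j)

InK : CombLabel → Set
InK (lA _) = ⊥
InK (lM _) = ⊥
InK (lX _) = ⊤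
InK (lY _) = ⊤

IsM : CombLabel → Set
IsM (lM _) = ⊤
IsM (lA _) = ⊥
IsM (lX _) = ⊥
IsM (lY _) = ⊥

-- The edges of G′ between S and K, in terms of the labels of their endpoints.
data StableCliqueEdge′ (n l : ℕ) : CombLabel → CombLabel → Set where
  A-X  : ∀ {i j} → j ≤ i → i < n → StableCliqueEdge′ n l (lA (suc i)) (lX (suc j))
  A-X₁ : ∀ {i} → StableCliqueEdge′ n l (lA i) (lX 1)
  A-Y  : ∀ {i k} → StableCliqueEdge′ n l (lA i) (lY (suc (suc k)))
  M-Y  : ∀ {i k} → i ≤ k → k < l → StableCliqueEdge′ n l (lM (suc i)) (lY (suc (suc k)))

aLevel-lower : ∀ l i → suc l ≤ aLevel l i
aLevel-lower l zero    = ≤-refl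
aLevel-lower l (suc i) = s≤s (m≤n+m l i)

aLevel-upper : ∀ l {n i} → i ≤ n → aLevel l i ≤ suc (n + l)
aLevel-upper l {n} {zero} _   = s≤s (m≤n+m l n)
aLevel-upper l {i = suc i} i<n = s≤s (+-monoˡ-≤ l (<⇒≤ i<n))

yLevel-bounds : ∀ l j → 1 ≤ j → 1 ≤ yLevel l j × yLevel l j ≤ suc l
yLevel-bounds l (suc j) _ with suc j ≤? suc l
... | yes j<1+l = m<n⇒0<n∸m j<1+l , m∸n≤m (suc l) j
... | no  _     = s≤s z≤n , ≤-refl

yLevel-below : ∀ l {k} → k < l → yLevel l (suc (suc k)) ≡ l ∸ k
yLevel-below l {k} k<l with suc (suc k) ≤? suc l
... | yes _  = refl
... | no 2+k≰1+l = contradiction (s≤s k<l) 2+k≰1+l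

yLevel-≤-∸ : ∀ l {i k} → i < l → yLevel l (suc (suc k)) ≤ l ∸ i → i ≤ k × k < l
yLevel-≤-∸ l {i} {k} i<l le with suc (suc k) ≤? suc l
... | yes (s≤s k<l) = ∸-cancelʳ-≤ (<⇒≤ i<l) le , k<l
... | no  _         = contradiction (≤-trans le (m∸n≤m l i)) 1+n≰n

InK⇔IsX : ∀ l {p} → InK p ⇔ IsX (combLevel l p)
InK⇔IsX l {lA _} = ⇔-id _
InK⇔IsX l {lM _} = ⇔-id _
InK⇔IsX l {lX _} = ⇔-id _
InK⇔IsX l {lY _} = ⇔-id _

module _ {n l : ℕ} where

  combLevel-valid : ∀ {p} → ValidCombLabel n l p → ValidThrLabel (suc (n + l)) (combLevel l p)
  combLevel-valid {lA i} i≤n = aLevel-upper l i≤n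
  combLevel-valid {lM i} _ = ≤-trans (m∸n≤m (suc l) i) (s≤s (m≤n+m l n))
  combLevel-valid {lX (suc j)} (_ , j≤n) = s≤s z≤n , m≤n⇒m≤1+n (+-monoˡ-≤ l j≤n)
  combLevel-valid {lY j} (2≤j , _) =
    proj₁ bounds , ≤-trans (proj₂ bounds) (s≤s (m≤n⇒m≤1+n (m≤n+m l n)))
    where bounds = yLevel-bounds l j (≤-trans (s≤s z≤n) 2≤j)

  stableCliqueEdge⇒AXEdge : ∀ {p q} → ValidCombLabel n l p → StableCliqueEdge′ n l p q →
                            AXEdge (suc (n + l)) (combLevel l p) (combLevel l q)
  stableCliqueEdge⇒AXEdge {lA (suc i)} i<n (A-X j≤i _) = s≤s z≤n , s≤s (+-monoˡ-≤ l j≤i) , aLevel-upper l i<n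
  stableCliqueEdge⇒AXEdge {lA i} i≤n A-X₁ = s≤s z≤n , aLevel-lower l i , aLevel-upper l i≤n
  stableCliqueEdge⇒AXEdge {lA i} {lY j} i≤n A-Y  =
    proj₁ bounds , ≤-trans (proj₂ bounds) (aLevel-lower l i) , aLevel-upper l i≤n
    where bounds = yLevel-bounds l j (s≤s z≤n)
  stableCliqueEdge⇒AXEdge {lM (suc i)} {lY j} _ (M-Y i≤k k<l) =
    proj₁ (yLevel-bounds l j (s≤s z≤n)) ,
    subst (_≤ l ∸ i) (sym (yLevel-below l k<l)) (∸-monoʳ-≤ l i≤k) ,
    ≤-trans (m∸n≤m l i) (m≤n⇒m≤1+n (m≤n+m l n))

  AXEdge⇒stableCliqueEdge : ∀ {p q} → ValidCombLabel n l p → ValidCombLabel n l q →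
                            AXEdge (suc (n + l)) (combLevel l p) (combLevel l q) → StableCliqueEdge′ n l p q
  AXEdge⇒stableCliqueEdge {lA i}       {lX (suc zero)}    _   _ _ = A-X₁
  AXEdge⇒stableCliqueEdge {lA zero}    {lX (suc (suc j))} _   _ (_ , 2+j+l≤1+l , _) =
    contradiction (≤-pred 2+j+l≤1+l) (m+1+n≰m l ∘ ≤-trans (≤-reflexive (+-comm l (suc j))))
  AXEdge⇒stableCliqueEdge {lA (suc i)} {lX (suc (suc j))} i<n _ (_ , s≤s 1+j+l≤i+l , _) =
    A-X (+-cancelʳ-≤ l (suc j) i 1+j+l≤i+l) i<n
  AXEdge⇒stableCliqueEdge {lA i} {lY (suc (suc k))} _ _ _ = A-Y
  AXEdge⇒stableCliqueEdge {lA i} {lY (suc zero)} _ (s≤s () , _) _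
  AXEdge⇒stableCliqueEdge {lM (suc i)} {lX (suc j)} _ _ (_ , 1+j+l≤l∸i , _) =
    contradiction (≤-trans (s≤s (m≤n+m l j)) (≤-trans 1+j+l≤l∸i (m∸n≤m l i))) 1+n≰n
  AXEdge⇒stableCliqueEdge {lM (suc i)} {lY (suc (suc k))} (_ , i<l) _ (_ , le , _) =
    let i≤k , k<l = yLevel-≤-∸ l i<l le in M-Y i≤k k<l
  AXEdge⇒stableCliqueEdge {lM (suc i)} {lY (suc zero)} _ (s≤s () , _) _

splitEdge : ∀ {N} {Adj : Fin N → Fin N → Set} {S K u v} → CompleteSplit Adj S K → S u → K v → Adj u v
splitEdge (_ , _ , complete) = complete _ _

module _ {N : ℕ} (G : SimpleGraph N) (n l : ℕ) (part : Fin N → CombLabel)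
         (comb : IsGeneralizedComb G n l part) where

  open SimpleGraph G renaming (sym to Adj-sym)
  open CombSets part
  open IsGeneralizedComb comb

  PrunedEdge : Fin N → Fin N → Set
  PrunedEdge u v = (InK (part u) × InK (part v) × u ≢ v) ⊎ StableCliqueEdge′ n l (part u) (part v)

  private
    Removed : Fin N → Fin N → Set
    Removed = RemovedEdge G n l part

    inK⇒InK : ∀ {v} → inK v → InK (part v)
    inK⇒InK (inj₁ (_ , e))           = subst InK (sym e) tt
    inK⇒InK (inj₂ (suc zero , e))    = subst InK (sym e) tt
    inK⇒InK (inj₂ (suc (suc _) , e)) = subst InK (sym e) tt

    InK⇒inK : ∀ {v p} → part v ≡ p → ValidCombLabel n l p → InK p → inK v
    InK⇒inK {p = lX i}             e _ _ = inj₁ (i , e)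
    InK⇒inK {p = lY (suc (suc k))} e _ _ = inj₂ (suc (suc k) , e)
    InK⇒inK {p = lY (suc zero)}    _ (s≤s () , _) _

    InK⇒¬IsM : ∀ {p} → InK p → ¬ IsM p
    InK⇒¬IsM {lX _} _ ()
    InK⇒¬IsM {lY _} _ ()

    inY-index : ∀ {v i j} → part v ≡ lY j → inY i v → i ≡ j
    inY-index {i = suc zero}    ev yv = contradiction (trans (sym ev) yv) λ ()
    inY-index {i = suc (suc k)} ev yv with trans (sym yv) ev
    ... | refl = refl

    removed-sym : ∀ {u v} → Removed u v → Removed v u
    removed-sym (i , 1≤i , i≤l , inj₁ e) = i , 1≤i , i≤l , inj₂ e
    removed-sym (i , 1≤i , i≤l , inj₂ e) = i , 1≤i , i≤l , inj₁ e

    notRemoved : ∀ {u v p q} → part u ≡ p → part v ≡ q → ¬ IsM p → ¬ IsM q → ¬ Removed u v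
    notRemoved eu ev ¬Mp ¬Mq (_ , _ , _ , inj₁ (_ , mv)) = ¬Mq (subst IsM (trans (sym mv) ev) tt)
    notRemoved eu ev ¬Mp ¬Mq (_ , _ , _ , inj₂ (_ , mu)) = ¬Mp (subst IsM (trans (sym mu) eu) tt)

    notRemoved-M-Y : ∀ {u v i k} → part u ≡ lM (suc i) → part v ≡ lY (suc (suc k)) → i ≤ k → ¬ Removed u v
    notRemoved-M-Y eu ev i≤k (_ , _ , _ , inj₁ (_ , mv)) = contradiction (trans (sym ev) mv) λ ()
    notRemoved-M-Y eu ev i≤k (_ , _ , _ , inj₂ (yv , mu)) with trans (sym eu) mu
    ... | refl = 1+n≰n (subst (_≤ _) (suc-injective (inY-index ev yv)) i≤k)

    stableCliqueEdge⇒adj′ : ∀ {u v p q} → part u ≡ p → part v ≡ q →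
                            StableCliqueEdge′ n l p q → Adj' G n l part u v
    stableCliqueEdge⇒adj′ eu ev (A-X j≤i i<n) =
      splitEdge (AX-complete _ _ (s≤s z≤n) (s≤s j≤i) i<n) eu ev , notRemoved eu ev (λ ()) (λ ())
    stableCliqueEdge⇒adj′ eu ev A-X₁ = splitEdge AY-complete (_ , eu) (1 , ev) , notRemoved eu ev (λ ()) (λ ())
    stableCliqueEdge⇒adj′ {q = lY j} eu ev A-Y = splitEdge AY-complete (_ , eu) (j , ev) , notRemoved eu ev (λ ()) (λ ())
    stableCliqueEdge⇒adj′ eu ev (M-Y i≤k k<l) =
      splitEdge (YM-complete _ _ (s≤s z≤n) (s≤s (s≤s i≤k)) (s≤s k<l)) eu ev , notRemoved-M-Y eu ev i≤k

    prunedEdge⇒adj′ : ∀ {u v} → PrunedEdge u v → Adj' G n l part u v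
    prunedEdge⇒adj′ {u} {v} (inj₁ (Ku , Kv , u≢v)) =
      K-clique u v (InK⇒inK refl (valid u) Ku) (InK⇒inK refl (valid v) Kv) u≢v ,
      notRemoved refl refl (InK⇒¬IsM Ku) (InK⇒¬IsM Kv)
    prunedEdge⇒adj′ (inj₂ e) = stableCliqueEdge⇒adj′ refl refl e

    stableClique : ∀ {u v p q} → part u ≡ p → part v ≡ q → StableCliqueEdge′ n l p q → PrunedEdge u v
    stableClique eu ev e = inj₂ (subst₂ (StableCliqueEdge′ n l) (sym eu) (sym ev) e)

    combEdge⇒prunedEdge : ∀ {u v} → Adj u v → ¬ Removed u v → CombEdge G n l part u v → PrunedEdge u v
    combEdge⇒prunedEdge uv _ (inj₁ (Ku , Kv)) = inj₁ (inK⇒InK Ku , inK⇒InK Kv , λ { refl → irrefl uv })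
    combEdge⇒prunedEdge _ _ (inj₂ (inj₁ (suc i , suc j , _ , s≤s j≤i , i<n , eu , ev))) =
      stableClique eu ev (A-X j≤i i<n)
    combEdge⇒prunedEdge _ _ (inj₂ (inj₂ (inj₁ ((_ , eu) , (suc zero , ev))))) = stableClique eu ev A-X₁
    combEdge⇒prunedEdge _ _ (inj₂ (inj₂ (inj₁ ((_ , eu) , (suc (suc _) , ev))))) = stableClique eu ev A-Y
    combEdge⇒prunedEdge _ ¬removed (inj₂ (inj₂ (inj₂ (inj₁ (i , 1≤i , i≤l , mu , yv))))) =
      contradiction (i , 1≤i , i≤l , inj₂ (yv , mu)) ¬removed
    combEdge⇒prunedEdge _ _ (inj₂ (inj₂ (inj₂ (inj₂ (suc i , suc (suc k) , _ , s≤s (s≤s i≤k) , s≤s k<l , mu , yv))))) =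
      stableClique mu yv (M-Y i≤k k<l)

  adj′⇔prunedEdge : ∀ u v → Adj' G n l part u v ⇔ (PrunedEdge u v ⊎ PrunedEdge v u)
  adj′⇔prunedEdge u v = mk⇔ to from
    where
    to : Adj' G n l part u v → PrunedEdge u v ⊎ PrunedEdge v u
    to (uv , ¬removed) with only-edges u v uv
    ... | inj₁ e = inj₁ (combEdge⇒prunedEdge uv ¬removed e)
    ... | inj₂ e = inj₂ (combEdge⇒prunedEdge (Adj-sym uv) (¬removed ∘ removed-sym) e)
    from : PrunedEdge u v ⊎ PrunedEdge v u → Adj' G n l part u v
    from (inj₁ e) = prunedEdge⇒adj′ e
    from (inj₂ e) = let vu , ¬removed = prunedEdge⇒adj′ e in Adj-sym vu , ¬removed ∘ removed-sym

  prunedEdge⇔levelEdge : ∀ u v → PrunedEdge u v ⇔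
                         LevelEdge (suc (n + l)) (combLevel l (part u)) (combLevel l (part v)) (u ≢ v)
  prunedEdge⇔levelEdge u v =
    (InK⇔IsX l ×-⇔ InK⇔IsX l ×-⇔ ⇔-id _) ⊎-⇔
    mk⇔ (stableCliqueEdge⇒AXEdge (valid u)) (AXEdge⇒stableCliqueEdge (valid u) (valid v))

  pruned-weakThreshold : IsWeakThresholdWith (Adj' G n l part) (suc (n + l)) (combLevel l ∘ part)
  pruned-weakThreshold = record
    { valid = combLevel-valid ∘ valid
    ; adj⇔  = λ u v → (prunedEdge⇔levelEdge u v ⊎-⇔ prunedEdge⇔levelEdge v u) ⇔-∘ adj′⇔prunedEdge u v
    }

mainTheorem2 : (N : ℕ) (G : SimpleGraph N) (n l : ℕ) (part : Fin N → CombLabel) →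
    IsGeneralizedComb G n l part →
    IsThreshold (Adj' G n l part)
mainTheorem2 N G n l part comb =
  weakThreshold⇒threshold (Adj' G n l part) (suc (n + l)) (pruned-weakThreshold G n l part comb)
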